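{- $PF\leq_c FLO$ and $FLO\not\leq_c PF$.
   Context: All structures are in a finite relational language and have universe a subset of $\omega$; a class of structures consists of structures in a single language and is closed under isomorphism (among structures with universe a subset of $\omega$). $D(\mathcal{A})$ denotes the atomic diagram (atomic sentences and negations of atomic sentences, with elements of $\omega$ as constants, true in $\mathcal{A}$). A computable transformation from $K$ to $K'$ is a c.e. set $\Phi$ of pairs $(\alpha,\varphi)$, $\alpha$ a finite subset of the atomic diagram of a finite structure in the language of $K$, $\varphi$ an atomic sentence or negated atomic sentence in the language of $K'$, such that for each $\mathcal{A}\in K$, $\{\varphi:\exists\alpha\subseteq D(\mathcal{A}),(\alpha,\varphi)\in\Phi\}=D(\mathcal{B})$ for some $\mathcal{B}\in K'$ (write $\Phi(\mathcal{A})=\mathcal{B}$). A computable embedding is a computable transformation with $\mathcal{A}\cong\mathcal{A}'$ iff $\Phi(\mathcal{A})\cong\Phi(\mathcal{A}')$ for all $\mathcal{A},\mathcal{A}'\in K$; $K\leq_c K'$ means a computable embedding of $K$ into $K'$ exists. $PF$ is the class of finite prime fields $\mathbb{F}_p$ (as structures in a relational language, operations and constants replaced by their graphs); $FLO$ is the class of finite linear orders. -}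

module Defs where

open import Data.Nat using (ℕ; zero; suc; _+_; _*_; _<_)
open import Data.Nat.Primality using (Prime)
open import Data.Fin using (Fin; toℕ) renaming (zero to fz; suc to fs)
open import Data.Vec using (Vec; []; _∷_; lookup) renaming (map to vmap)
open import Data.Vec.Relation.Unary.All using () renaming (All to VAll)
open import Data.List using (List; []; _∷_)
open import Data.List.Relation.Unary.All using (All)
open import Data.List.Membership.Propositional using (_∈_)
open import Data.Product using (Σ; _×_; _,_; ∃)
open import Data.Sum using (_⊎_)
open import Relation.Nullary using (¬_)
open import Relation.Binary.PropositionalEquality using (_≡_)

_⟺_ : Set → Set → Set
A ⟺ B = (A → B) × (B → A)

-- Partial recursive (μ-recursive) functions, with big-step semantics.
-- A set of naturals is c.e. iff it is the domain of such a function.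

data Rec : ℕ → Set where
  zer  : ∀ {n} → Rec n
  succ : Rec 1
  proj : ∀ {n} → Fin n → Rec n
  comp : ∀ {n k} → Rec k → Vec (Rec n) k → Rec n
  prec : ∀ {n} → Rec n → Rec (suc (suc n)) → Rec (suc n)
  mu   : ∀ {n} → Rec (suc n) → Rec n

mutual
  data _⟦_⟧⇓_ : ∀ {n} → Rec n → Vec ℕ n → ℕ → Set where
    ev-zer   : ∀ {n} {xs : Vec ℕ n} → zer ⟦ xs ⟧⇓ 0
    ev-succ  : ∀ {x} → succ ⟦ x ∷ [] ⟧⇓ suc x
    ev-proj  : ∀ {n} {i : Fin n} {xs} → proj i ⟦ xs ⟧⇓ lookup xs i
    ev-comp  : ∀ {n k} {f : Rec k} {gs : Vec (Rec n) k} {xs ys r} →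
               gs ⟦ xs ⟧⇓* ys → f ⟦ ys ⟧⇓ r → comp f gs ⟦ xs ⟧⇓ r
    ev-prec0 : ∀ {n} {g : Rec n} {h xs r} →
               g ⟦ xs ⟧⇓ r → prec g h ⟦ 0 ∷ xs ⟧⇓ r
    ev-precS : ∀ {n} {g : Rec n} {h xs m r r'} →
               prec g h ⟦ m ∷ xs ⟧⇓ r → h ⟦ m ∷ r ∷ xs ⟧⇓ r' →
               prec g h ⟦ suc m ∷ xs ⟧⇓ r'
    ev-mu    : ∀ {n} {f : Rec (suc n)} {xs r} →
               MinFrom f xs 0 r → mu f ⟦ xs ⟧⇓ r

  data _⟦_⟧⇓*_ : ∀ {n k} → Vec (Rec n) k → Vec ℕ n → Vec ℕ k → Set where
    ev-[] : ∀ {n} {xs : Vec ℕ n} → [] ⟦ xs ⟧⇓* []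
    ev-∷  : ∀ {n k} {g : Rec n} {gs : Vec (Rec n) k} {xs y ys} →
            g ⟦ xs ⟧⇓ y → gs ⟦ xs ⟧⇓* ys → (g ∷ gs) ⟦ xs ⟧⇓* (y ∷ ys)

  data MinFrom {n} (f : Rec (suc n)) (xs : Vec ℕ n) : ℕ → ℕ → Set where
    min-here : ∀ {y} → f ⟦ y ∷ xs ⟧⇓ 0 → MinFrom f xs y y
    min-next : ∀ {y z r} → f ⟦ y ∷ xs ⟧⇓ suc z →
               MinFrom f xs (suc y) r → MinFrom f xs y r

Halts : Rec 1 → ℕ → Set
Halts e x = ∃ λ v → e ⟦ x ∷ [] ⟧⇓ v

record Lang : Set where
  field
    sym : ℕ
    ar  : Fin sym → ℕ
open Lang public

record Str (L : Lang) : Set₁ where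
  field
    U : ℕ → Set
    R : (i : Fin (sym L)) → Vec ℕ (ar L i) → Set
open Str public

Class : Lang → Set₁
Class L = Str L → Set

Finite : ∀ {L} → Str L → Set
Finite A = Σ (List ℕ) λ xs → ∀ x → U A x ⟺ (x ∈ xs)

record Iso {L : Lang} (A B : Str L) : Set where
  field
    f     : ℕ → ℕ
    g     : ℕ → ℕ
    f-U   : ∀ x → U A x → U B (f x)
    g-U   : ∀ y → U B y → U A (g y)
    gf    : ∀ x → U A x → g (f x) ≡ x
    fg    : ∀ y → U B y → f (g y) ≡ y
    f-rel : ∀ i (v : Vec ℕ (ar L i)) → VAll (U A) v →
            R A i v ⟺ R B i (vmap f v)

data Atom (L : Lang) : Set where
  eq  : ℕ → ℕ → Atom L
  rel : (i : Fin (sym L)) → Vec ℕ (ar L i) → Atom L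

data Lit (L : Lang) : Set where
  pos : Atom L → Lit L
  neg : Atom L → Lit L

constsIn : ∀ {L} → Str L → Atom L → Set
constsIn A (eq a b)  = U A a × U A b
constsIn A (rel i v) = VAll (U A) v

truth : ∀ {L} → Str L → Atom L → Set
truth A (eq a b)  = a ≡ b
truth A (rel i v) = R A i v

D : ∀ {L} → Str L → Lit L → Set
D A (pos t) = constsIn A t × truth A t
D A (neg t) = constsIn A t × ¬ truth A t

tri : ℕ → ℕ
tri zero    = zero
tri (suc n) = suc n + tri n

⟨_,_⟩ : ℕ → ℕ → ℕ
⟨ a , b ⟩ = tri (a + b) + b

codeVec : ∀ {k} → Vec ℕ k → ℕ
codeVec []       = 0
codeVec (x ∷ xs) = suc ⟨ x , codeVec xs ⟩

codeAtom : ∀ {L} → Atom L → ℕ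
codeAtom (eq a b)  = ⟨ 0 , ⟨ a , b ⟩ ⟩
codeAtom (rel i v) = ⟨ suc (toℕ i) , codeVec v ⟩

codeLit : ∀ {L} → Lit L → ℕ
codeLit (pos t) = ⟨ 0 , codeAtom t ⟩
codeLit (neg t) = ⟨ 1 , codeAtom t ⟩

codeLits : ∀ {L} → List (Lit L) → ℕ
codeLits []       = 0
codeLits (l ∷ ls) = suc ⟨ codeLit l , codeLits ls ⟩

codePair : ∀ {L L'} → List (Lit L) → Lit L' → ℕ
codePair α φ = ⟨ codeLits α , codeLit φ ⟩

-- Computable transformations / embeddings.
-- The c.e. set Φ is W_e = dom(e), read through the coding codePair.

InΦ : ∀ {L L'} → Rec 1 → List (Lit L) → Lit L' → Set
InΦ e α φ = Halts e (codePair α φ)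

Out : ∀ {L L'} → Rec 1 → Str L → Str L' → Set
Out {L} e A B =
  ∀ φ → (Σ (List (Lit L)) λ α → All (D A) α × InΦ e α φ) ⟺ D B φ

record IsCompTransf {L L'} (K : Class L) (K' : Class L') (e : Rec 1) : Set₁ where
  field
    wf    : ∀ (α : List (Lit L)) (φ : Lit L') → InΦ e α φ →
            Σ (Str L) λ F → Finite F × All (D F) α
    total : ∀ A → K A → Σ (Str L') λ B → K' B × Out e A B

record IsCompEmb {L L'} (K : Class L) (K' : Class L') (e : Rec 1) : Set₁ where
  field
    transf : IsCompTransf K K' e
    embed  : ∀ (A A' : Str L) (B B' : Str L') → K A → K A' → Out e A B → Out e A' B' →
             Iso A A' ⟺ Iso B B'

_≤c_ : ∀ {L L'} → Class L → Class L' → Set₁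
K ≤c K' = Σ (Rec 1) λ e → IsCompEmb K K' e

-- language of fields: graphs of + , · (ternary) and of 0 , 1 (unary)
arPF : Fin 4 → ℕ
arPF fz                = 3
arPF (fs fz)           = 3
arPF (fs (fs fz))      = 1
arPF (fs (fs (fs fz))) = 1

LPF : Lang
LPF = record { sym = 4 ; ar = arPF }

fpRel : ℕ → (i : Fin 4) → Vec ℕ (arPF i) → Set
fpRel p fz                (a ∷ b ∷ c ∷ []) =
  a < p × b < p × c < p × (a + b ≡ c ⊎ a + b ≡ c + p)
fpRel p (fs fz)           (a ∷ b ∷ c ∷ []) =
  a < p × b < p × c < p × (Σ ℕ λ q → a * b ≡ q * p + c)
fpRel p (fs (fs fz))      (a ∷ []) = a < p × a ≡ 0
fpRel p (fs (fs (fs fz))) (a ∷ []) = a < p × a ≡ 1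

Fp : ℕ → Str LPF
Fp p = record { U = λ x → x < p ; R = fpRel p }

PF : Class LPF
PF A = Σ ℕ λ p → Prime p × Iso (Fp p) A

LLO : Lang
LLO = record { sym = 1 ; ar = λ _ → 2 }

module _ (A : Str LLO) where
  private
    _≼_ : ℕ → ℕ → Set
    x ≼ y = R A fz (x ∷ y ∷ [])

  IsLinOrd : Set
  IsLinOrd =
    (∀ x → U A x → x ≼ x) ×
    (∀ x y → U A x → U A y → x ≼ y → y ≼ x → x ≡ y) ×
    (∀ x y z → U A x → U A y → U A z → x ≼ y → y ≼ z → x ≼ z) ×
    (∀ x y → U A x → U A y → (x ≼ y) ⊎ (y ≼ x))

FLO : Class LLO
FLO A = Finite A × IsLinOrd A

module Submission where

-- PF ≤c FLO.  Φ sends a structure A to its universe ordered by the natural order of ℕ.  If A ≅ 𝔽_p then Φ(A) ≅ Ord p via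
-- the rank map, and p is an isomorphism invariant on both sides, so Φ is an embedding.
--
-- Computable transformations are monotone in the atomic diagram, and
-- D(Ord 1) ⊆ D(Ord 2).  An embedding into PF would therefore give copies of 𝔽_p and 𝔽_q
-- with nested diagrams, i.e. a field embedding 𝔽_p → 𝔽_q, which forces p = q; then
-- Φ(Ord 1) ≅ Φ(Ord 2) although Ord 1 ≇ Ord 2.

open import Defs hiding (sym)
open import Data.Product using (Σ; _×_; _,_; ∃; proj₁; proj₂)
open import Relation.Nullary using (¬_; yes; no)

open import Data.Empty using (⊥; ⊥-elim)
open import Data.Sum using (_⊎_; inj₁; inj₂)
open import Data.Nat using (ℕ; zero; suc; _+_; _*_; _∸_; ∣_-_∣; pred; _≤_; _<_; z≤n; s≤s; z<s; _<?_; nonTrivial⇒n>1)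
open import Data.Nat.Properties
open import Data.Nat.Divisibility using (0∣⇒≡0)
open import Data.Nat.Primality using (Prime; prime⇒nonTrivial)
open import Data.Nat.ListAction using (product)
open import Data.Nat.ListAction.Properties using (∈⇒∣product)
open import Data.Fin using (Fin; toℕ; fromℕ<; punchOut) renaming (zero to fz; suc to fs)
open import Data.Fin.Properties
  using (toℕ-injective; toℕ<n; toℕ-fromℕ<; fromℕ<-injective; injective⇒≤; any?; punchOut-injective)
  renaming (_≟_ to _≟ᶠ_)
open import Data.Vec using (Vec; []; _∷_; lookup; head; tail) renaming (map to vmap)
open import Data.Vec.Properties using (map-∘; map-id)
open import Data.Vec.Relation.Unary.All using ([]; _∷_) renaming (All to VAll)
import Data.Vec.Relation.Unary.All as VAll
import Data.Vec.Relation.Unary.All.Properties as VAllₚ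
open import Data.List using (List; []; _∷_; map; applyUpTo; upTo)
open import Data.List.Relation.Unary.Any using (here; there)
open import Data.List.Relation.Unary.All using (All; []; _∷_)
import Data.List.Relation.Unary.All as All
open import Data.List.Membership.Propositional using (_∈_)
open import Data.List.Membership.Propositional.Properties
  using (∈-map⁺; ∈-map⁻; ∈-applyUpTo⁺; ∈-applyUpTo⁻; ∈-upTo⁺; ∈-upTo⁻)
open import Relation.Unary using (Decidable)
open import Relation.Binary.Definitions using (tri<; tri≈; tri>)
open import Relation.Binary.PropositionalEquality hiding ([_])

record Computable (n : ℕ) (s : Vec ℕ n → ℕ) : Set where
  field
    program    : Rec n
    computes   : ∀ xs → program ⟦ xs ⟧⇓ s xs
    functional : ∀ {xs v} → program ⟦ xs ⟧⇓ v → v ≡ s xs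
open Computable

record Computable* (n k : ℕ) (s : Vec ℕ n → Vec ℕ k) : Set where
  field
    programs    : Vec (Rec n) k
    computes*   : ∀ xs → programs ⟦ xs ⟧⇓* s xs
    functional* : ∀ {xs vs} → programs ⟦ xs ⟧⇓* vs → vs ≡ s xs
open Computable*

[]ᶜ : ∀ {n} → Computable* n 0 (λ _ → [])
[]ᶜ = record { programs = [] ; computes* = λ _ → ev-[] ; functional* = λ { ev-[] → refl } }

infixr 5 _∷ᶜ_
_∷ᶜ_ : ∀ {n k s ss} → Computable n s → Computable* n k ss →
       Computable* n (suc k) (λ xs → s xs ∷ ss xs)
C ∷ᶜ Cs = record
  { programs    = program C ∷ programs Cs
  ; computes*   = λ xs → ev-∷ (computes C xs) (computes* Cs xs)
  ; functional* = λ { (ev-∷ d ds) → cong₂ _∷_ (functional C d) (functional* Cs ds) } }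

computable-comp : ∀ {n k f gs} → Computable k f → Computable* n k gs →
                  Computable n (λ xs → f (gs xs))
computable-comp F Gs = record
  { program    = comp (program F) (programs Gs)
  ; computes   = λ xs → ev-comp (computes* Gs xs) (computes F _)
  ; functional = λ { (ev-comp ds d) → trans (functional F d) (cong _ (functional* Gs ds)) } }

computable-ext : ∀ {n s t} → Computable n s → (∀ xs → s xs ≡ t xs) → Computable n t
computable-ext C s≗t = record
  { program    = program C
  ; computes   = λ xs → subst (program C ⟦ xs ⟧⇓_) (s≗t xs) (computes C xs)
  ; functional = λ d → trans (functional C d) (s≗t _) }

computable-zero : ∀ {n} → Computable n (λ _ → 0)
computable-zero = record { program = zer ; computes = λ _ → ev-zer ; functional = λ { ev-zer → refl } }

computable-proj : ∀ {n} (i : Fin n) → Computable n (λ xs → lookup xs i)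
computable-proj i =
  record { program = proj i ; computes = λ _ → ev-proj ; functional = λ { ev-proj → refl } }

computable-succ : Computable 1 (λ xs → suc (head xs))
computable-succ = record
  { program = succ ; computes = λ { (x ∷ []) → ev-succ } ; functional = λ { ev-succ → refl } }

primRec : ∀ {n} → (Vec ℕ n → ℕ) → (Vec ℕ (suc (suc n)) → ℕ) → Vec ℕ (suc n) → ℕ
primRec g h (zero  ∷ xs) = g xs
primRec g h (suc m ∷ xs) = h (m ∷ primRec g h (m ∷ xs) ∷ xs)

computable-primRec : ∀ {n g h} → Computable n g → Computable (suc (suc n)) h →
                     Computable (suc n) (primRec g h)
computable-primRec {g = g} {h} G H =
  record { program = prec (program G) (program H) ; computes = run ; functional = unique }
  where
    run : ∀ xs → prec (program G) (program H) ⟦ xs ⟧⇓ primRec g h xs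
    run (zero  ∷ xs) = ev-prec0 (computes G xs)
    run (suc m ∷ xs) = ev-precS (run (m ∷ xs)) (computes H _)
    unique : ∀ {xs v} → prec (program G) (program H) ⟦ xs ⟧⇓ v → v ≡ primRec g h xs
    unique (ev-prec0 dg) = functional G dg
    unique (ev-precS dr dh) rewrite unique dr = functional H dh

unary : (ℕ → ℕ) → Vec ℕ 1 → ℕ
unary f xs = f (head xs)

binary : (ℕ → ℕ → ℕ) → Vec ℕ 2 → ℕ
binary f xs = f (head xs) (head (tail xs))

private
  x₀ : ∀ {n} → Computable (suc n) (λ xs → lookup xs fz)
  x₀ = computable-proj fz
  x₁ : ∀ {n} → Computable (suc (suc n)) (λ xs → lookup xs (fs fz))
  x₁ = computable-proj (fs fz)
  x₂ : ∀ {n} → Computable (suc (suc (suc n))) (λ xs → lookup xs (fs (fs fz)))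
  x₂ = computable-proj (fs (fs fz))
  apply₁ : ∀ {n f g} → Computable 1 f → Computable n g → Computable n (λ xs → f (g xs ∷ []))
  apply₁ F G = computable-comp F (G ∷ᶜ []ᶜ)
  apply₂ : ∀ {n f g g'} → Computable 2 f → Computable n g → Computable n g' →
           Computable n (λ xs → f (g xs ∷ g' xs ∷ []))
  apply₂ F G G' = computable-comp F (G ∷ᶜ G' ∷ᶜ []ᶜ)

computable-+ : Computable 2 (binary _+_)
computable-+ = computable-ext (computable-primRec x₀ (apply₁ computable-succ x₁)) sum
  where
    sum : ∀ xs → _ ≡ binary _+_ xs
    sum (zero  ∷ b ∷ []) = refl
    sum (suc a ∷ b ∷ []) = cong suc (sum (a ∷ b ∷ []))

computable-* : Computable 2 (binary _*_)
computable-* = computable-ext (computable-primRec computable-zero (apply₂ computable-+ x₂ x₁)) prod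
  where
    prod : ∀ xs → _ ≡ binary _*_ xs
    prod (zero  ∷ b ∷ []) = refl
    prod (suc a ∷ b ∷ []) = cong (b +_) (prod (a ∷ b ∷ []))

computable-pred : Computable 1 (unary pred)
computable-pred = computable-ext (computable-primRec computable-zero x₀)
  λ { (zero ∷ []) → refl ; (suc a ∷ []) → refl }

-- Truncated subtraction, by recursion on the subtrahend.
computable-∸ : Computable 2 (binary _∸_)
computable-∸ = computable-ext (computable-comp minus (x₁ ∷ᶜ x₀ ∷ᶜ []ᶜ))
  λ { (a ∷ b ∷ []) → monus b a }
  where
    minus : Computable 2 (primRec (λ xs → lookup xs fz) (λ xs → pred (lookup xs (fs fz))))
    minus = computable-primRec x₀ (apply₁ computable-pred x₁)
    monus : ∀ b a → primRec _ _ (b ∷ a ∷ []) ≡ a ∸ b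
    monus zero    a = refl
    monus (suc b) a = trans (cong pred (monus b a)) (pred[m∸n]≡m∸[1+n] a b)

computable-tri : Computable 1 (unary tri)
computable-tri = computable-ext
  (computable-primRec computable-zero (apply₂ computable-+ (apply₁ computable-succ x₀) x₁)) triangle
  where
    triangle : ∀ xs → _ ≡ unary tri xs
    triangle (zero  ∷ []) = refl
    triangle (suc a ∷ []) = cong (suc a +_) (triangle (a ∷ []))

∣m-n∣≡m∸n+n∸m : ∀ m n → ∣ m - n ∣ ≡ (m ∸ n) + (n ∸ m)
∣m-n∣≡m∸n+n∸m zero    zero    = refl
∣m-n∣≡m∸n+n∸m zero    (suc n) = refl
∣m-n∣≡m∸n+n∸m (suc m) zero    = sym (+-identityʳ (suc m))
∣m-n∣≡m∸n+n∸m (suc m) (suc n) = ∣m-n∣≡m∸n+n∸m m n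

computable-∣-∣ : Computable 2 (binary ∣_-_∣)
computable-∣-∣ = computable-ext
  (apply₂ computable-+ (apply₂ computable-∸ x₀ x₁) (apply₂ computable-∸ x₁ x₀))
  λ { (a ∷ b ∷ []) → sym (∣m-n∣≡m∸n+n∸m a b) }

infixl 6 _`+_
infixl 7 _`*_
data Expr (n : ℕ) : Set where
  var        : Fin n → Expr n
  const      : ℕ → Expr n
  `suc `tri  : Expr n → Expr n
  _`+_ _`*_  : Expr n → Expr n → Expr n
  `∣_-_∣     : Expr n → Expr n → Expr n

⟦_⟧ : ∀ {n} → Expr n → Vec ℕ n → ℕ
⟦ var i ⟧     ρ = lookup ρ i
⟦ const k ⟧   ρ = k
⟦ `suc e ⟧    ρ = suc (⟦ e ⟧ ρ)
⟦ `tri e ⟧    ρ = tri (⟦ e ⟧ ρ)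
⟦ a `+ b ⟧    ρ = ⟦ a ⟧ ρ + ⟦ b ⟧ ρ
⟦ a `* b ⟧    ρ = ⟦ a ⟧ ρ * ⟦ b ⟧ ρ
⟦ `∣ a - b ∣ ⟧ ρ = ∣ ⟦ a ⟧ ρ - ⟦ b ⟧ ρ ∣

computable-const : ∀ {n} k → Computable n (λ _ → k)
computable-const zero    = computable-zero
computable-const (suc k) = apply₁ computable-succ (computable-const k)

compile : ∀ {n} (e : Expr n) → Computable n ⟦ e ⟧
compile (var i)      = computable-proj i
compile (const k)    = computable-const k
compile (`suc e)     = apply₁ computable-succ (compile e)
compile (`tri e)     = apply₁ computable-tri (compile e)
compile (a `+ b)     = apply₂ computable-+ (compile a) (compile b)
compile (a `* b)     = apply₂ computable-* (compile a) (compile b)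
compile `∣ a - b ∣   = apply₂ computable-∣-∣ (compile a) (compile b)

infix 8 _[_]
_[_] : ∀ {m n} → Expr m → Vec (Expr n) m → Expr n
var i        [ σ ] = lookup σ i
const k      [ σ ] = const k
`suc e       [ σ ] = `suc (e [ σ ])
`tri e       [ σ ] = `tri (e [ σ ])
(a `+ b)     [ σ ] = (a [ σ ]) `+ (b [ σ ])
(a `* b)     [ σ ] = (a [ σ ]) `* (b [ σ ])
`∣ a - b ∣   [ σ ] = `∣ a [ σ ] - b [ σ ] ∣

-- Bounded products f 0 · f 1 ⋯ f m, the primitive recursive form of ∃ c ≤ m.
∏≤ : (ℕ → ℕ) → ℕ → ℕ
∏≤ f zero    = f zero
∏≤ f (suc m) = ∏≤ f m * f (suc m)

∏≤≡0⇔ : ∀ f m → (∏≤ f m ≡ 0) ⟺ (∃ λ c → c ≤ m × f c ≡ 0)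
∏≤≡0⇔ f m = to m , from m
  where
    to : ∀ m → ∏≤ f m ≡ 0 → ∃ λ c → c ≤ m × f c ≡ 0
    to zero    f0≡0 = zero , z≤n , f0≡0
    to (suc m) ∏≡0 with m*n≡0⇒m≡0∨n≡0 (∏≤ f m) ∏≡0
    ... | inj₁ ∏m≡0 = let (c , c≤m , fc≡0) = to m ∏m≡0 in c , m≤n⇒m≤1+n c≤m , fc≡0
    ... | inj₂ fm≡0 = suc m , ≤-refl , fm≡0
    from : ∀ m → (∃ λ c → c ≤ m × f c ≡ 0) → ∏≤ f m ≡ 0
    from zero    (.zero , z≤n , f0≡0) = f0≡0
    from (suc m) (c , c≤1+m , fc≡0) with m≤n⇒m<n∨m≡n c≤1+m
    ... | inj₁ c<1+m = cong (_* f (suc m)) (from m (c , m<1+n⇒m≤n c<1+m , fc≡0))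
    ... | inj₂ refl  = trans (cong (∏≤ f m *_) fc≡0) (*-zeroʳ (∏≤ f m))

computable-∏≤ : ∀ {n} {q : ℕ → Vec ℕ n → ℕ} → Computable n (q 0) →
                Computable (suc (suc n)) (λ v → head (tail v) * q (suc (head v)) (tail (tail v))) →
                Computable (suc n) (λ v → ∏≤ (λ c → q c (tail v)) (head v))
computable-∏≤ {q = q} G H = computable-ext (computable-primRec G H) unfold
  where
    unfold : ∀ v → primRec _ _ v ≡ ∏≤ (λ c → q c (tail v)) (head v)
    unfold (zero  ∷ xs) = refl
    unfold (suc m ∷ xs) = cong (_* q (suc m) xs) (unfold (m ∷ xs))

product≡0⇔ : ∀ ns → (product ns ≡ 0) ⟺ (0 ∈ ns)
product≡0⇔ ns = to ns , λ 0∈ns → 0∣⇒≡0 (∈⇒∣product 0∈ns)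
  where
    to : ∀ ns → product ns ≡ 0 → 0 ∈ ns
    to (n ∷ ns) ∏≡0 with m*n≡0⇒m≡0∨n≡0 n ∏≡0
    ... | inj₁ refl  = here refl
    ... | inj₂ ∏≡0′ = there (to ns ∏≡0′)

μ-halts⇔ : ∀ {s} (C : Computable 2 s) n →
           Halts (mu (program C)) n ⟺ (∃ λ x → s (x ∷ n ∷ []) ≡ 0)
μ-halts⇔ {s} C n = (λ { (_ , ev-mu search) → found search })
                 , (λ (x , sx≡0) → _ , ev-mu (proj₂ (from x sx≡0 x 0 (+-identityʳ x))))
  where
    found : ∀ {y r} → MinFrom (program C) (n ∷ []) y r → ∃ λ x → s (x ∷ n ∷ []) ≡ 0
    found (min-here d)     = _ , sym (functional C d)
    found (min-next _ rest) = found rest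
    from : ∀ x → s (x ∷ n ∷ []) ≡ 0 → ∀ d y → d + y ≡ x → ∃ λ r → MinFrom (program C) (n ∷ []) y r
    from x sx≡0 d y d+y≡x with s (y ∷ n ∷ []) in sy | computes C (y ∷ n ∷ [])
    ... | zero  | run = y , min-here run
    from x sx≡0 zero    y refl | suc _ | _ = ⊥-elim (0≢1+n (trans (sym sx≡0) sy))
    from x sx≡0 (suc d) y d+y≡x | suc _ | run =
      let (r , rest) = from x sx≡0 d (suc y) (trans (+-suc d y) d+y≡x) in r , min-next run rest

-- Injectivity of the coding: ⟨ a , b ⟩ lies in [tri (a + b), tri (1 + a + b)),
-- so it determines the diagonal a + b and then b.
tri-mono : ∀ {a b} → a ≤ b → tri a ≤ tri b
tri-mono {zero}  {b}     _         = z≤n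
tri-mono {suc a} {suc b} (s≤s a≤b) = +-mono-≤ (s≤s a≤b) (tri-mono a≤b)

n≤tri : ∀ n → n ≤ tri n
n≤tri zero    = z≤n
n≤tri (suc n) = m≤m+n (suc n) (tri n)

a≤⟨a,b⟩ : ∀ a b → a ≤ ⟨ a , b ⟩
a≤⟨a,b⟩ a b = ≤-trans (m≤m+n a b) (≤-trans (n≤tri (a + b)) (m≤m+n (tri (a + b)) b))

b≤⟨a,b⟩ : ∀ a b → b ≤ ⟨ a , b ⟩
b≤⟨a,b⟩ a b = m≤n+m b (tri (a + b))

⟨⟩-diagonal-mono : ∀ a b a′ b′ → a + b < a′ + b′ → ⟨ a , b ⟩ < ⟨ a′ , b′ ⟩
⟨⟩-diagonal-mono a b a′ b′ lt = begin-strict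
  tri (a + b) + b          ≤⟨ +-monoʳ-≤ (tri (a + b)) (m≤n+m b a) ⟩
  tri (a + b) + (a + b)    ≡⟨ +-comm (tri (a + b)) (a + b) ⟩
  tri (suc (a + b)) ∸ 1    <⟨ n<1+n _ ⟩
  tri (suc (a + b))        ≤⟨ tri-mono lt ⟩
  tri (a′ + b′)            ≤⟨ m≤m+n (tri (a′ + b′)) b′ ⟩
  ⟨ a′ , b′ ⟩              ∎
  where open ≤-Reasoning

⟨⟩-injective : ∀ a b a′ b′ → ⟨ a , b ⟩ ≡ ⟨ a′ , b′ ⟩ → a ≡ a′ × b ≡ b′
⟨⟩-injective a b a′ b′ same = +-cancelʳ-≡ b a a′ (trans diag (cong (a′ +_) (sym b≡b′))) , b≡b′
  where
    diag : a + b ≡ a′ + b′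
    diag with <-cmp (a + b) (a′ + b′)
    ... | tri< lt _ _ = ⊥-elim (<-irrefl same (⟨⟩-diagonal-mono a b a′ b′ lt))
    ... | tri≈ _ e _  = e
    ... | tri> _ _ gt = ⊥-elim (<-irrefl (sym same) (⟨⟩-diagonal-mono a′ b′ a b gt))
    b≡b′ : b ≡ b′
    b≡b′ = +-cancelˡ-≡ (tri (a + b)) b b′ (trans same (cong (λ t → tri t + b′) (sym diag)))

codeVec-injective : ∀ {k} (v w : Vec ℕ k) → codeVec v ≡ codeVec w → v ≡ w
codeVec-injective []      []      _    = refl
codeVec-injective (x ∷ v) (y ∷ w) same =
  let (x≡y , rest) = ⟨⟩-injective x (codeVec v) y (codeVec w) (suc-injective same)
  in cong₂ _∷_ x≡y (codeVec-injective v w rest)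

codeAtom-injective : ∀ {L} (s t : Atom L) → codeAtom s ≡ codeAtom t → s ≡ t
codeAtom-injective (eq a b) (eq a′ b′) same =
  let (a≡a′ , b≡b′) = ⟨⟩-injective a b a′ b′ (proj₂ (⟨⟩-injective 0 ⟨ a , b ⟩ 0 ⟨ a′ , b′ ⟩ same))
  in cong₂ eq a≡a′ b≡b′
codeAtom-injective (eq a b) (rel i v) same =
  ⊥-elim (0≢1+n (proj₁ (⟨⟩-injective 0 ⟨ a , b ⟩ (suc (toℕ i)) (codeVec v) same)))
codeAtom-injective (rel i v) (eq a b) same =
  ⊥-elim (0≢1+n (sym (proj₁ (⟨⟩-injective (suc (toℕ i)) (codeVec v) 0 ⟨ a , b ⟩ same))))
codeAtom-injective (rel i v) (rel j w) same
  with ⟨⟩-injective (suc (toℕ i)) (codeVec v) (suc (toℕ j)) (codeVec w) same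
... | i≡j , v≡w with toℕ-injective {i = i} {j} (suc-injective i≡j)
... | refl = cong (rel i) (codeVec-injective v w v≡w)

codeLit-injective : ∀ {L} (s t : Lit L) → codeLit s ≡ codeLit t → s ≡ t
codeLit-injective (pos a) (pos b) same =
  cong pos (codeAtom-injective a b (proj₂ (⟨⟩-injective 0 (codeAtom a) 0 (codeAtom b) same)))
codeLit-injective (neg a) (neg b) same =
  cong neg (codeAtom-injective a b (proj₂ (⟨⟩-injective 1 (codeAtom a) 1 (codeAtom b) same)))
codeLit-injective (pos a) (neg b) same =
  ⊥-elim (0≢1+n (proj₁ (⟨⟩-injective 0 (codeAtom a) 1 (codeAtom b) same)))
codeLit-injective (neg a) (pos b) same =
  ⊥-elim (0≢1+n (sym (proj₁ (⟨⟩-injective 1 (codeAtom a) 0 (codeAtom b) same))))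

codeLits-injective : ∀ {L} (α β : List (Lit L)) → codeLits α ≡ codeLits β → α ≡ β
codeLits-injective []      []      _    = refl
codeLits-injective (l ∷ α) (m ∷ β) same =
  let (l≡m , rest) = ⟨⟩-injective (codeLit l) (codeLits α) (codeLit m) (codeLits β) (suc-injective same)
  in cong₂ _∷_ (codeLit-injective l m l≡m) (codeLits-injective α β rest)

codePair-injective : ∀ {L L′} (α β : List (Lit L)) (φ ψ : Lit L′) →
                     codePair α φ ≡ codePair β ψ → α ≡ β × φ ≡ ψ
codePair-injective α β φ ψ same =
  let (α≡β , φ≡ψ) = ⟨⟩-injective (codeLits α) (codeLit φ) (codeLits β) (codeLit ψ) same
  in codeLits-injective α β α≡β , codeLit-injective φ ψ φ≡ψ

⟺-refl : ∀ {A : Set} → A ⟺ A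
⟺-refl = (λ a → a) , (λ a → a)

injection⇒≤ : ∀ m n (f : ℕ → ℕ) → (∀ i → i < m → f i < n) →
              (∀ i j → i < m → j < m → f i ≡ f j → i ≡ j) → m ≤ n
injection⇒≤ m n f f< f-inj = injective⇒≤ {f = F} F-injective
  where
    F : Fin m → Fin n
    F i = fromℕ< (f< (toℕ i) (toℕ<n i))
    F-injective : ∀ {i j} → F i ≡ F j → i ≡ j
    F-injective {i} {j} Fi≡Fj = toℕ-injective (f-inj (toℕ i) (toℕ j) (toℕ<n i) (toℕ<n j)
      (fromℕ<-injective _ _ (f< (toℕ i) (toℕ<n i)) (f< (toℕ j) (toℕ<n j)) Fi≡Fj))

All-map : ∀ {P Q : ℕ → Set} {f : ℕ → ℕ} {k} {v : Vec ℕ k} →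
          (∀ x → P x → Q (f x)) → VAll P v → VAll Q (vmap f v)
All-map P⇒Q pv = VAllₚ.map⁺ (VAll.map (P⇒Q _) pv)

map-cancel : ∀ {P : ℕ → Set} {f g : ℕ → ℕ} {k} {v : Vec ℕ k} →
             (∀ x → P x → f (g x) ≡ x) → VAll P v → vmap f (vmap g v) ≡ v
map-cancel fg []        = refl
map-cancel fg (px ∷ pv) = cong₂ _∷_ (fg _ px) (map-cancel fg pv)

module _ {L : Lang} where

  Iso-sym : {A B : Str L} → Iso A B → Iso B A
  Iso-sym {A} {B} i = record
    { f = g ; g = f ; f-U = g-U ; g-U = f-U ; gf = fg ; fg = gf
    ; f-rel = λ j v Bv →
        let fgv≡v = map-cancel fg Bv
            rel⇔  = f-rel j (vmap g v) (All-map g-U Bv)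
        in (λ Rv → proj₂ rel⇔ (subst (R B j) (sym fgv≡v) Rv))
         , (λ Rgv → subst (R B j) fgv≡v (proj₁ rel⇔ Rgv)) }
    where open Iso i

  Iso-trans : {A B C : Str L} → Iso A B → Iso B C → Iso A C
  Iso-trans {A} {B} {C} i₁ i₂ = record
    { f = λ x → f₂ (f₁ x) ; g = λ y → g₁ (g₂ y)
    ; f-U = λ x Ax → f-U₂ _ (f-U₁ x Ax)
    ; g-U = λ y Cy → g-U₁ _ (g-U₂ y Cy)
    ; gf = λ x Ax → trans (cong g₁ (gf₂ _ (f-U₁ x Ax))) (gf₁ x Ax)
    ; fg = λ y Cy → trans (cong f₂ (fg₁ _ (g-U₂ y Cy))) (fg₂ y Cy)
    ; f-rel = λ j v Av →
        let rel⇔₁ = f-rel₁ j v Av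
            rel⇔₂ = f-rel₂ j (vmap f₁ v) (All-map f-U₁ Av)
            comp  = map-∘ f₂ f₁ v
        in (λ Rv → subst (R C j) (sym comp) (proj₁ rel⇔₂ (proj₁ rel⇔₁ Rv)))
         , (λ Rv → proj₂ rel⇔₁ (proj₂ rel⇔₂ (subst (R C j) comp Rv))) }
    where
      open Iso i₁ renaming (f to f₁; g to g₁; f-U to f-U₁; g-U to g-U₁; gf to gf₁; fg to fg₁; f-rel to f-rel₁)
      open Iso i₂ renaming (f to f₂; g to g₂; f-U to f-U₂; g-U to g-U₂; gf to gf₂; fg to fg₂; f-rel to f-rel₂)

  Iso-via : ∀ (Z : ℕ → Str L) {X Y : Str L} {p p′} → Iso X (Z p) → p ≡ p′ → Iso (Z p′) Y → Iso X Y
  Iso-via Z X≅Zp refl Zp≅Y = Iso-trans X≅Zp Zp≅Y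

  -- Membership of x in the universe is the literal x = x, so it is carried along
  -- inclusions of diagrams.
  universe-⊆ : {X Y : Str L} → (∀ φ → D X φ → D Y φ) → ∀ {x} → U X x → U Y x
  universe-⊆ X⊆Y {x} Xx = proj₁ (proj₁ (X⊆Y (pos (eq x x)) ((Xx , Xx) , refl)))

  sameDiagram⇒Iso : {B B′ : Str L} → (∀ φ → D B φ → D B′ φ) → (∀ φ → D B′ φ → D B φ) → Iso B B′
  sameDiagram⇒Iso {B} {B′} B⊆B′ B′⊆B = record
    { f = λ x → x ; g = λ x → x
    ; f-U = λ x → universe-⊆ B⊆B′ ; g-U = λ x → universe-⊆ B′⊆B
    ; gf = λ _ _ → refl ; fg = λ _ _ → refl
    ; f-rel = λ i v Bv →
        (λ Rv → subst (R B′ i) (sym (map-id v)) (proj₂ (B⊆B′ (pos (rel i v)) (Bv , Rv))))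
      , (λ Rv → proj₂ (B′⊆B (pos (rel i v))
                  ( subst (VAll (U B′)) (map-id v) (All-map (λ _ → universe-⊆ B⊆B′) Bv)
                  , subst (R B′ i) (map-id v) Rv))) }

  Iso⇒≤ : ∀ {X Y : Str L} {p q} → Iso X Y → (∀ x → x < p → U X x) → (∀ y → U Y y → y < q) → p ≤ q
  Iso⇒≤ {p = p} {q} i p⊆X Y⊆q = injection⇒≤ p q f (λ x x<p → Y⊆q _ (f-U x (p⊆X x x<p)))
    (λ a b a<p b<p fa≡fb → trans (sym (gf a (p⊆X a a<p))) (trans (cong g fa≡fb) (gf b (p⊆X b b<p))))
    where open Iso i

  Iso⇒≡ : ∀ {X Y : Str L} {p q} → Iso X Y → (∀ x → U X x ⟺ (x < p)) → (∀ y → U Y y ⟺ (y < q)) → p ≡ q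
  Iso⇒≡ i X≃p Y≃q = ≤-antisym
    (Iso⇒≤ i (λ x → proj₂ (X≃p x)) (λ y → proj₁ (Y≃q y)))
    (Iso⇒≤ (Iso-sym i) (λ y → proj₂ (Y≃q y)) (λ x → proj₁ (X≃p x)))

  Iso⇒Finite : ∀ {X Y : Str L} {p} → (∀ x → U X x ⟺ (x < p)) → Iso X Y → Finite Y
  Iso⇒Finite {Y = Y} {p} X≃p i = applyUpTo f p , λ y →
      (λ Yy → subst (_∈ applyUpTo f p) (fg y Yy) (∈-applyUpTo⁺ f (proj₁ (X≃p _) (g-U y Yy))))
    , (λ y∈ → let (x , x<p , y≡fx) = ∈-applyUpTo⁻ f y∈
              in subst (U Y) (sym y≡fx) (f-U x (proj₂ (X≃p x) x<p)))
    where open Iso i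

count : ∀ {P : ℕ → Set} → Decidable P → ℕ → ℕ
count P? zero    = zero
count P? (suc n) with P? n
... | yes _ = suc (count P? n)
... | no  _ = count P? n

module _ {P : ℕ → Set} (P? : Decidable P) where

  count-≤ : ∀ n → count P? n ≤ n
  count-≤ zero    = z≤n
  count-≤ (suc n) with P? n
  ... | yes _ = s≤s (count-≤ n)
  ... | no  _ = m≤n⇒m≤1+n (count-≤ n)

  count-< : ∀ {i n} → i < n → ¬ P i → count P? n < n
  count-< {i} {suc n} i<1+n ¬Pi with P? n | m<1+n⇒m<n∨m≡n i<1+n
  ... | yes _  | inj₁ i<n  = s≤s (count-< i<n ¬Pi)
  ... | yes Pn | inj₂ refl = ⊥-elim (¬Pi Pn)
  ... | no  _  | _         = s≤s (count-≤ n)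

  module _ {Q : ℕ → Set} (Q? : Decidable Q) (P⇒Q : ∀ {i} → P i → Q i) where

    count-mono : ∀ n → count P? n ≤ count Q? n
    count-mono zero    = z≤n
    count-mono (suc n) with P? n | Q? n
    ... | yes _  | yes _  = s≤s (count-mono n)
    ... | yes Pn | no ¬Qn = ⊥-elim (¬Qn (P⇒Q Pn))
    ... | no  _  | yes _  = m≤n⇒m≤1+n (count-mono n)
    ... | no  _  | no  _  = count-mono n

    count-strict : ∀ {i n} → i < n → ¬ P i → Q i → count P? n < count Q? n
    count-strict {i} {suc n} i<1+n ¬Pi Qi with P? n | Q? n | m<1+n⇒m<n∨m≡n i<1+n
    ... | yes Pn | no ¬Qn | _         = ⊥-elim (¬Qn (P⇒Q Pn))
    ... | yes _  | yes _  | inj₁ i<n  = s≤s (count-strict i<n ¬Pi Qi)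
    ... | yes Pn | yes _  | inj₂ refl = ⊥-elim (¬Pi Pn)
    ... | no  _  | yes _  | _         = s≤s (count-mono n)
    ... | no  _  | no  _  | inj₁ i<n  = count-strict i<n ¬Pi Qi
    ... | no  _  | no ¬Qn | inj₂ refl = ⊥-elim (¬Qn Qi)

injective⇒onto : ∀ {n} (F : Fin n → Fin n) → (∀ {i j} → F i ≡ F j → i ≡ j) → ∀ r → ∃ λ i → F i ≡ r
injective⇒onto {suc n} F F-injective r with any? (λ i → F i ≟ᶠ r)
... | yes hit  = hit
... | no  miss = ⊥-elim (1+n≰n (injective⇒≤ {f = avoid} avoid-injective))
  where
    -- F misses r, so punching r out gives an injection Fin (1 + n) → Fin n
    r≢F : ∀ i → r ≢ F i
    r≢F i r≡Fi = miss (i , sym r≡Fi)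
    avoid : Fin (suc n) → Fin n
    avoid i = punchOut (r≢F i)
    avoid-injective : ∀ {i j} → avoid i ≡ avoid j → i ≡ j
    avoid-injective {i} {j} same = F-injective (punchOut-injective (r≢F i) (r≢F j) same)

natLe : Fin 1 → Vec ℕ 2 → Set
natLe _ (a ∷ b ∷ []) = a ≤ b

natOrder : (ℕ → Set) → Str LLO
natOrder S = record { U = S ; R = natLe }

Ord : ℕ → Str LLO
Ord p = natOrder (_< p)

natOrder-linear : ∀ S → IsLinOrd (natOrder S)
natOrder-linear S = (λ _ _ → ≤-refl) , (λ _ _ _ _ → ≤-antisym) , (λ _ _ _ _ _ _ → ≤-trans)
                  , (λ x y _ _ → ≤-total x y)

-- A set of naturals in bijection with [0,p) (the universe of a structure isomorphic to
-- one with universe [0,p)) is order-isomorphic to Ord p, by sending y to its rank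
-- #{ x < p | f x < y }.
module Rank {L : Lang} {X Y : Str L} {p : ℕ} (X≃p : ∀ x → U X x ⟺ (x < p)) (i : Iso X Y) where
  open Iso i

  f∈Y : ∀ {x} → x < p → U Y (f x)
  f∈Y {x} x<p = f-U x (proj₂ (X≃p x) x<p)

  g<p : ∀ {y} → U Y y → g y < p
  g<p {y} Yy = proj₁ (X≃p (g y)) (g-U y Yy)

  rank : ℕ → ℕ
  rank y = count (λ x → f x <? y) p

  rank<p : ∀ y → U Y y → rank y < p
  rank<p y Yy = count-< (λ x → f x <? y) (g<p Yy) (<-irrefl (fg y Yy))

  rank-strict : ∀ {y z} → U Y y → U Y z → y < z → rank y < rank z
  rank-strict {y} {z} Yy Yz y<z = count-strict (λ x → f x <? y) (λ x → f x <? z) (λ fx<y → <-trans fx<y y<z)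
    (g<p Yy) (<-irrefl (fg y Yy)) (subst (_< z) (sym (fg y Yy)) y<z)

  rank-≤⇔ : ∀ {y z} → U Y y → U Y z → (y ≤ z) ⟺ (rank y ≤ rank z)
  rank-≤⇔ {y} {z} Yy Yz = monotone , reflects
    where
      monotone : y ≤ z → rank y ≤ rank z
      monotone y≤z with m≤n⇒m<n∨m≡n y≤z
      ... | inj₁ y<z  = <⇒≤ (rank-strict Yy Yz y<z)
      ... | inj₂ refl = ≤-refl
      reflects : rank y ≤ rank z → y ≤ z
      reflects ry≤rz with <-cmp y z
      ... | tri< y<z _ _ = <⇒≤ y<z
      ... | tri≈ _ y≡z _ = ≤-reflexive y≡z
      ... | tri> _ _ z<y = ⊥-elim (<⇒≱ (rank-strict Yz Yy z<y) ry≤rz)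

  rank-injective : ∀ {y z} → U Y y → U Y z → rank y ≡ rank z → y ≡ z
  rank-injective Yy Yz ry≡rz =
    ≤-antisym (proj₂ (rank-≤⇔ Yy Yz) (≤-reflexive ry≡rz)) (proj₂ (rank-≤⇔ Yz Yy) (≤-reflexive (sym ry≡rz)))

  -- every r < p is a rank: rank ∘ f is an injective endomap of [0,p)
  rank-onto : ∀ {r} → r < p → ∃ λ x → x < p × rank (f x) ≡ r
  rank-onto {r} r<p =
    let (x , Fx≡r) = injective⇒onto F F-injective (fromℕ< r<p)
    in toℕ x , toℕ<n x , trans (sym (toℕ-fromℕ< _)) (trans (cong toℕ Fx≡r) (toℕ-fromℕ< r<p))
    where
      F : Fin p → Fin p
      F x = fromℕ< (rank<p (f (toℕ x)) (f∈Y (toℕ<n x)))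
      F-injective : ∀ {x x′} → F x ≡ F x′ → x ≡ x′
      F-injective {x} {x′} Fx≡Fx′ = toℕ-injective (begin
        toℕ x              ≡⟨ gf (toℕ x) (proj₂ (X≃p _) (toℕ<n x)) ⟨
        g (f (toℕ x))      ≡⟨ cong g (rank-injective (f∈Y (toℕ<n x)) (f∈Y (toℕ<n x′))
                                (fromℕ<-injective _ _ _ _ Fx≡Fx′)) ⟩
        g (f (toℕ x′))     ≡⟨ gf (toℕ x′) (proj₂ (X≃p _) (toℕ<n x′)) ⟩
        toℕ x′             ∎)
        where open ≡-Reasoning

  unrank : ℕ → ℕ
  unrank r with r <? p
  ... | yes r<p = f (proj₁ (rank-onto r<p))
  ... | no  _   = 0

  unrank∈Y : ∀ r → r < p → U Y (unrank r)
  unrank∈Y r r<p with r <? p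
  ... | yes r<p′ = f∈Y (proj₁ (proj₂ (rank-onto r<p′)))
  ... | no  r≮p  = ⊥-elim (r≮p r<p)

  rank-unrank : ∀ r → r < p → rank (unrank r) ≡ r
  rank-unrank r r<p with r <? p
  ... | yes r<p′ = proj₂ (proj₂ (rank-onto r<p′))
  ... | no  r≮p  = ⊥-elim (r≮p r<p)

  unrank-rank : ∀ y → U Y y → unrank (rank y) ≡ y
  unrank-rank y Yy = rank-injective (unrank∈Y _ (rank<p y Yy)) Yy (rank-unrank _ (rank<p y Yy))

  rankIso : Iso (natOrder (U Y)) (Ord p)
  rankIso = record
    { f = rank ; g = unrank ; f-U = rank<p ; g-U = unrank∈Y ; gf = unrank-rank ; fg = rank-unrank
    ; f-rel = λ { _ (a ∷ b ∷ []) (Ya ∷ Yb ∷ []) → rank-≤⇔ Ya Yb } }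

-- The pairs of Φ.  Φ(A) should be the universe of A in its natural order, so Φ contains,
-- for a , b ∈ ℕ, the pair ({a = a , b = b} , φ) for every literal φ about a , b that is
-- true in (ℕ , ≤).  These are enumerated by a shape and two numbers x , c.
data Shape : Set where
  equal below above leq nleq : Shape

shapes : List Shape
shapes = equal ∷ below ∷ above ∷ leq ∷ nleq ∷ []

shape∈shapes : ∀ s → s ∈ shapes
shape∈shapes equal = here refl
shape∈shapes below = there (here refl)
shape∈shapes above = there (there (here refl))
shape∈shapes leq   = there (there (there (here refl)))
shape∈shapes nleq  = there (there (there (there (here refl))))

leftE rightE : Shape → Expr 2
leftE  equal = var fz
leftE  below = var fz
leftE  above = `suc (var (fs fz) `+ var fz)
leftE  leq   = var fz
leftE  nleq  = `suc (var (fs fz) `+ var fz)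
rightE equal = var fz
rightE below = `suc (var (fs fz) `+ var fz)
rightE above = var fz
rightE leq   = var (fs fz) `+ var fz
rightE nleq  = var fz

left right : Shape → ℕ → ℕ → ℕ
left  s x c = ⟦ leftE s ⟧ (x ∷ c ∷ [])
right s x c = ⟦ rightE s ⟧ (x ∷ c ∷ [])

-- The literal "a = a", which lies in D(A) exactly when a is in the universe of A.
inUniverse : ℕ → Lit LPF
inUniverse a = pos (eq a a)

premises : ℕ → ℕ → List (Lit LPF)
premises a b = inUniverse a ∷ inUniverse b ∷ []

literal : Shape → ℕ → ℕ → Lit LLO
literal equal a b = pos (eq a b)
literal below a b = neg (eq a b)
literal above a b = neg (eq a b)
literal leq   a b = pos (rel fz (a ∷ b ∷ []))
literal nleq  a b = neg (rel fz (a ∷ b ∷ []))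

IsΦPair : List (Lit LPF) → Lit LLO → Set
IsΦPair α φ = Σ Shape λ s → Σ ℕ λ x → Σ ℕ λ c →
  let a = left s x c ; b = right s x c in α ≡ premises a b × φ ≡ literal s a b

code : Shape → ℕ → ℕ → ℕ
code s x c = codePair (premises (left s x c) (right s x c)) (literal s (left s x c) (right s x c))

⟨_,_⟩ᴱ : ∀ {n} → Expr n → Expr n → Expr n
⟨ a , b ⟩ᴱ = `tri (a `+ b) `+ b

literalE : ∀ {n} → Shape → Expr n → Expr n → Expr n
literalE equal a b = ⟨ const 0 , ⟨ const 0 , ⟨ a , b ⟩ᴱ ⟩ᴱ ⟩ᴱ
literalE below a b = ⟨ const 1 , ⟨ const 0 , ⟨ a , b ⟩ᴱ ⟩ᴱ ⟩ᴱ
literalE above a b = ⟨ const 1 , ⟨ const 0 , ⟨ a , b ⟩ᴱ ⟩ᴱ ⟩ᴱ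
literalE leq   a b = ⟨ const 0 , ⟨ const 1 , `suc ⟨ a , `suc ⟨ b , const 0 ⟩ᴱ ⟩ᴱ ⟩ᴱ ⟩ᴱ
literalE nleq  a b = ⟨ const 1 , ⟨ const 1 , `suc ⟨ a , `suc ⟨ b , const 0 ⟩ᴱ ⟩ᴱ ⟩ᴱ ⟩ᴱ

premisesE : ∀ {n} → Expr n → Expr n → Expr n
premisesE a b = `suc ⟨ literalE equal a a , `suc ⟨ literalE equal b b , const 0 ⟩ᴱ ⟩ᴱ

codeE : Shape → Expr 2
codeE s = ⟨ premisesE (leftE s) (rightE s) , literalE s (leftE s) (rightE s) ⟩ᴱ

-- n is the code of a pair with parameters x , c iff Q c x n = 0; QE is Q as an
-- expression in the variables c , x , n (it denotes Q by evaluation).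
Q : ℕ → ℕ → ℕ → ℕ
Q c x n = product (map (λ s → ∣ n - code s x c ∣) shapes)

QE : Expr 3
QE = go shapes
  where
    go : List Shape → Expr 3
    go []       = const 1
    go (s ∷ ss) = `∣ var (fs (fs fz)) - codeE s [ var (fs fz) ∷ var fz ∷ [] ] ∣ `* go ss

-- The program eΦ: on input n, search for x with ∏_{c ≤ n} Q c x n = 0.
q : ℕ → Vec ℕ 2 → ℕ
q c v = Q c (head v) (head (tail v))

searched : Vec ℕ 2 → ℕ
searched v = ∏≤ (λ c → q c v) (head (tail v))

computable-searched : Computable 2 searched
computable-searched = computable-ext
  (computable-comp (computable-∏≤ {q = q} base step)
    (computable-proj (fs fz) ∷ᶜ computable-proj fz ∷ᶜ computable-proj (fs fz) ∷ᶜ []ᶜ))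
  λ { (x ∷ n ∷ []) → refl }
  where
    base : Computable 2 (q 0)
    base = computable-ext (compile (QE [ const 0 ∷ var fz ∷ var (fs fz) ∷ [] ]))
      λ { (x ∷ n ∷ []) → refl }
    step : Computable 4 (λ v → head (tail v) * q (suc (head v)) (tail (tail v)))
    step = computable-ext
      (compile (var (fs fz) `* QE [ `suc (var fz) ∷ var (fs (fs fz)) ∷ var (fs (fs (fs fz))) ∷ [] ]))
      λ { (c ∷ r ∷ x ∷ n ∷ []) → refl }

-- Kept opaque: the rest of the development only uses its halting set, eΦ-halts⇔.
opaque
  eΦ : Rec 1
  eΦ = mu (program computable-searched)

x<1+c+x : ∀ c x → x < suc (c + x)
x<1+c+x c x = s≤s (m≤n+m x c)

gap≤ : ∀ {a b} → a ≤ b → ∃ λ c → b ≡ c + a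
gap≤ a≤b = _ , sym (m∸n+n≡m a≤b)

gap< : ∀ {a b} → a < b → ∃ λ c → b ≡ suc (c + a)
gap< {a} a<b = let (c , b≡c+1+a) = gap≤ a<b in c , trans b≡c+1+a (+-suc c a)

-- Both constants of a pair are bounded by its code; hence so is c, for a suitable choice of c.
inUniverse≤ : ∀ a → a ≤ codeLit (inUniverse a)
inUniverse≤ a = ≤-trans (a≤⟨a,b⟩ a a) (≤-trans (b≤⟨a,b⟩ 0 ⟨ a , a ⟩) (b≤⟨a,b⟩ 0 ⟨ 0 , ⟨ a , a ⟩ ⟩))

premises≤ : ∀ a b → a ≤ codeLits (premises a b) × b ≤ codeLits (premises a b)
premises≤ a b = m≤n⇒m≤1+n (≤-trans (inUniverse≤ a) (a≤⟨a,b⟩ A B))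
              , m≤n⇒m≤1+n (≤-trans (m≤n⇒m≤1+n (≤-trans (inUniverse≤ b) (a≤⟨a,b⟩ (codeLit (inUniverse b)) 0)))
                                    (b≤⟨a,b⟩ A B))
  where
    A = codeLit (inUniverse a)
    B = codeLits (inUniverse b ∷ [])

endpoints≤code : ∀ s x c → left s x c ≤ code s x c × right s x c ≤ code s x c
endpoints≤code s x c = ≤-trans (proj₁ (premises≤ a b)) α≤code , ≤-trans (proj₂ (premises≤ a b)) α≤code
  where
    a = left s x c
    b = right s x c
    α≤code : codeLits (premises a b) ≤ code s x c
    α≤code = a≤⟨a,b⟩ (codeLits (premises a b)) (codeLit (literal s a b))

code-bound : ∀ s x c → ∃ λ c′ → c′ ≤ code s x c × code s x c′ ≡ code s x c
code-bound equal x c = 0 , z≤n , refl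
code-bound below x c = c , ≤-trans (m≤n⇒m≤1+n (m≤m+n c x)) (proj₂ (endpoints≤code below x c)) , refl
code-bound above x c = c , ≤-trans (m≤n⇒m≤1+n (m≤m+n c x)) (proj₁ (endpoints≤code above x c)) , refl
code-bound leq   x c = c , ≤-trans (m≤m+n c x) (proj₂ (endpoints≤code leq x c)) , refl
code-bound nleq  x c = c , ≤-trans (m≤n⇒m≤1+n (m≤m+n c x)) (proj₁ (endpoints≤code nleq x c)) , refl

opaque
  unfolding eΦ
  eΦ-halts⇔ : ∀ n → Halts eΦ n ⟺ (∃ λ s → ∃ λ x → ∃ λ c → n ≡ code s x c)
  eΦ-halts⇔ n = to , from
    where
      Q≡0⇔ : ∀ c x → (Q c x n ≡ 0) ⟺ (∃ λ s → n ≡ code s x c)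
      Q≡0⇔ c x = found , vanishes
        where
          distance : Shape → ℕ
          distance s = ∣ n - code s x c ∣
          found : product (map distance shapes) ≡ 0 → ∃ λ s → n ≡ code s x c
          found Q≡0 with ∈-map⁻ distance {xs = shapes} (proj₁ (product≡0⇔ (map distance shapes)) Q≡0)
          ... | s , _ , 0≡distance = s , ∣m-n∣≡0⇒m≡n (sym 0≡distance)
          vanishes : (∃ λ s → n ≡ code s x c) → product (map distance shapes) ≡ 0
          vanishes (s , n≡code) = proj₂ (product≡0⇔ (map distance shapes))
            (subst (_∈ map distance shapes) (m≡n⇒∣m-n∣≡0 n≡code) (∈-map⁺ distance (shape∈shapes s)))
      to : Halts eΦ n → ∃ λ s → ∃ λ x → ∃ λ c → n ≡ code s x c
      to halts = let (x , searched≡0) = proj₁ (μ-halts⇔ computable-searched n) halts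
                     (c , _ , Q≡0) = proj₁ (∏≤≡0⇔ _ n) searched≡0
                     (s , n≡code) = proj₁ (Q≡0⇔ c x) Q≡0
                 in s , x , c , n≡code
      from : (∃ λ s → ∃ λ x → ∃ λ c → n ≡ code s x c) → Halts eΦ n
      from (s , x , c , n≡code) =
        let (c′ , c′≤code , same) = code-bound s x c
            c′≤n = subst (c′ ≤_) (sym n≡code) c′≤code
        in proj₂ (μ-halts⇔ computable-searched n)
             (x , proj₂ (∏≤≡0⇔ _ n) (c′ , c′≤n , proj₂ (Q≡0⇔ c′ x) (s , trans n≡code (sym same))))

InΦ⇔IsΦPair : ∀ α φ → InΦ eΦ α φ ⟺ IsΦPair α φ
InΦ⇔IsΦPair α φ =
    (λ halts → let (s , x , c , same) = proj₁ (eΦ-halts⇔ (codePair α φ)) halts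
                   a = left s x c ; b = right s x c
                   (α≡ , φ≡) = codePair-injective α (premises a b) φ (literal s a b) same
               in s , x , c , α≡ , φ≡)
  , (λ { (s , x , c , refl , refl) → proj₂ (eΦ-halts⇔ _) (s , x , c , refl) })

literal-true : ∀ S s x c → S (left s x c) → S (right s x c) →
               D (natOrder S) (literal s (left s x c) (right s x c))
literal-true S equal x c Sa Sb = (Sa , Sb) , refl
literal-true S below x c Sa Sb = (Sa , Sb) , <⇒≢ (x<1+c+x c x)
literal-true S above x c Sa Sb = (Sa , Sb) , ≢-sym (<⇒≢ (x<1+c+x c x))
literal-true S leq   x c Sa Sb = (Sa ∷ Sb ∷ []) , m≤n+m x c
literal-true S nleq  x c Sa Sb = (Sa ∷ Sb ∷ []) , <⇒≱ (x<1+c+x c x)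

literal-complete : ∀ S φ → D (natOrder S) φ →
  Σ Shape λ s → Σ ℕ λ x → Σ ℕ λ c →
    φ ≡ literal s (left s x c) (right s x c) × S (left s x c) × S (right s x c)
literal-complete S (pos (eq a .a)) ((Sa , _) , refl) = equal , a , 0 , refl , Sa , Sa
literal-complete S (neg (eq a b)) ((Sa , Sb) , a≢b) with <-cmp a b
... | tri< a<b _ _ with gap< a<b
...   | c , refl = below , a , c , refl , Sa , Sb
literal-complete S (neg (eq a b)) ((Sa , Sb) , a≢b) | tri≈ _ a≡b _ = ⊥-elim (a≢b a≡b)
literal-complete S (neg (eq a b)) ((Sa , Sb) , a≢b) | tri> _ _ b<a with gap< b<a
...   | c , refl = above , b , c , refl , Sa , Sb
literal-complete S (pos (rel fz (a ∷ b ∷ []))) ((Sa ∷ Sb ∷ []) , a≤b) with gap≤ a≤b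
... | c , refl = leq , a , c , refl , Sa , Sb
literal-complete S (neg (rel fz (a ∷ b ∷ []))) ((Sa ∷ Sb ∷ []) , a≰b) with gap< (≰⇒> a≰b)
... | c , refl = nleq , b , c , refl , Sa , Sb

Φ-output : ∀ (A : Str LPF) → Out eΦ A (natOrder (U A))
Φ-output A φ = output , input
  where
    output : (Σ (List (Lit LPF)) λ α → All (D A) α × InΦ eΦ α φ) → D (natOrder (U A)) φ
    output (α , Dα , inΦ) with proj₁ (InΦ⇔IsΦPair α φ) inΦ
    ... | s , x , c , refl , refl with Dα
    ...   | ((Aa , _) , _) ∷ ((Ab , _) , _) ∷ [] = literal-true (U A) s x c Aa Ab
    input : D (natOrder (U A)) φ → Σ (List (Lit LPF)) λ α → All (D A) α × InΦ eΦ α φ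
    input Dφ with literal-complete (U A) φ Dφ
    ... | s , x , c , refl , Aa , Ab =
      premises _ _ , ((Aa , Aa) , refl) ∷ ((Ab , Ab) , refl) ∷ [] ,
      proj₂ (InΦ⇔IsΦPair _ _) (s , x , c , refl , refl)

-- Every premise list of Φ is realised in a finite structure: {a , b} with no relations.
premises-realised : ∀ a b → Σ (Str LPF) λ F → Finite F × All (D F) (premises a b)
premises-realised a b = F , ((a ∷ b ∷ []) , λ _ → ⟺-refl)
                      , ((here refl , here refl) , refl) ∷ ((there (here refl) , there (here refl)) , refl) ∷ []
  where
    F : Str LPF
    F = record { U = _∈ (a ∷ b ∷ []) ; R = λ _ _ → ⊥ }

Φ-wellformed : ∀ α φ → InΦ eΦ α φ → Σ (Str LPF) λ F → Finite F × All (D F) α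
Φ-wellformed α φ inΦ with proj₁ (InΦ⇔IsΦPair α φ) inΦ
... | s , x , c , refl , _ = premises-realised _ _

Out-mono : ∀ {L L′} {e : Rec 1} {A A′ : Str L} {B B′ : Str L′} → (∀ φ → D A φ → D A′ φ) →
           Out e A B → Out e A′ B′ → ∀ ψ → D B ψ → D B′ ψ
Out-mono A⊆A′ out out′ ψ DBψ =
  let (α , Dα , inΦ) = proj₂ (out ψ) DBψ
  in proj₁ (out′ ψ) (α , All.map (λ {φ} → A⊆A′ φ) Dα , inΦ)

Out-unique : ∀ {L L′} {e : Rec 1} {A : Str L} {B B′ : Str L′} → Out e A B → Out e A B′ → Iso B B′
Out-unique out out′ = sameDiagram⇒Iso (Out-mono (λ _ d → d) out out′) (Out-mono (λ _ d → d) out′ out)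

Φ-of-PF : ∀ {A B} → PF A → Out eΦ A B → Σ ℕ λ p → Iso (Fp p) A × Iso B (Ord p)
Φ-of-PF {A} (p , _ , Fp≅A) out =
  p , Fp≅A , Iso-trans (Out-unique out (Φ-output A)) (Rank.rankIso (λ _ → ⟺-refl) Fp≅A)

Φ-embedding : ∀ A A′ B B′ → PF A → PF A′ → Out eΦ A B → Out eΦ A′ B′ → Iso A A′ ⟺ Iso B B′
Φ-embedding A A′ B B′ PF-A PF-A′ out out′ with Φ-of-PF PF-A out | Φ-of-PF PF-A′ out′
... | p , Fp≅A , B≅Ord | p′ , Fp′≅A′ , B′≅Ord′ = to , from
  where
    to : Iso A A′ → Iso B B′
    to A≅A′ = Iso-via Ord B≅Ord p≡p′ (Iso-sym B′≅Ord′)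
      where
        p≡p′ : p ≡ p′
        p≡p′ = Iso⇒≡ (Iso-trans Fp≅A (Iso-trans A≅A′ (Iso-sym Fp′≅A′))) (λ _ → ⟺-refl) (λ _ → ⟺-refl)
    from : Iso B B′ → Iso A A′
    from B≅B′ = Iso-via Fp (Iso-sym Fp≅A) p≡p′ Fp′≅A′
      where
        p≡p′ : p ≡ p′
        p≡p′ = Iso⇒≡ (Iso-trans (Iso-sym B≅Ord) (Iso-trans B≅B′ B′≅Ord′)) (λ _ → ⟺-refl) (λ _ → ⟺-refl)

PF≤cFLO : PF ≤c FLO
PF≤cFLO = eΦ , record
  { transf = record
    { wf    = Φ-wellformed
    ; total = λ A (p , _ , Fp≅A) →
        natOrder (U A) , (Iso⇒Finite (λ _ → ⟺-refl) Fp≅A , natOrder-linear (U A)) , Φ-output A }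
  ; embed = Φ-embedding }

record FieldEmbedding (p q : ℕ) : Set where
  field
    emb        : ℕ → ℕ
    emb<q      : ∀ {x} → x < p → emb x < q
    injective  : ∀ {x y} → x < p → y < p → emb x ≡ emb y → x ≡ y
    preserves  : ∀ i v → VAll (_< p) v → fpRel p i v → fpRel q i (vmap emb v)

diagramInclusion⇒embedding : ∀ {p q B₁ B₂} → Iso (Fp p) B₁ → Iso (Fp q) B₂ →
                             (∀ φ → D B₁ φ → D B₂ φ) → FieldEmbedding p q
diagramInclusion⇒embedding {p} {q} {B₁} {B₂} i₁ i₂ B₁⊆B₂ = record
  { emb       = λ x → g₂ (f₁ x)
  ; emb<q     = λ {x} x<p → g-U₂ _ (B₁⊆B₂ᵁ (f-U₁ x x<p))
  ; injective = λ {x} {y} x<p y<p same → begin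
      x                ≡⟨ gf₁ x x<p ⟨
      g₁ (f₁ x)        ≡⟨ cong g₁ (begin
        f₁ x             ≡⟨ fg₂ _ (B₁⊆B₂ᵁ (f-U₁ x x<p)) ⟨
        f₂ (g₂ (f₁ x))   ≡⟨ cong f₂ same ⟩
        f₂ (g₂ (f₁ y))   ≡⟨ fg₂ _ (B₁⊆B₂ᵁ (f-U₁ y y<p)) ⟩
        f₁ y             ∎) ⟩
      g₁ (f₁ y)        ≡⟨ gf₁ y y<p ⟩
      y                ∎
  ; preserves = λ i v v<p Rv →
      let (B₂v , R₂v) = B₁⊆B₂ (pos (rel i (vmap f₁ v))) (All-map f-U₁ v<p , proj₁ (f-rel₁ i v v<p) Rv)
      in subst (fpRel q i) (sym (map-∘ g₂ f₁ v)) (proj₂ (f-rel₂ i (vmap g₂ (vmap f₁ v)) (All-map g-U₂ B₂v))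
           (subst (R B₂ i) (sym (map-cancel fg₂ B₂v)) R₂v)) }
  where
    open ≡-Reasoning
    open Iso i₁ renaming (f to f₁; g to g₁; f-U to f-U₁; gf to gf₁; f-rel to f-rel₁)
    open Iso i₂ renaming (f to f₂; g to g₂; g-U to g-U₂; fg to fg₂; f-rel to f-rel₂)
    B₁⊆B₂ᵁ : ∀ {y} → U B₁ y → U B₂ y
    B₁⊆B₂ᵁ = universe-⊆ B₁⊆B₂

-- A field embedding 𝔽_p → 𝔽_q forces p = q: injectivity gives p ≤ q, and if p < q then
-- preservation of 0 , 1 , + makes it the identity on [0,p), so that (p - 1) + 1 = 0 in 𝔽_p
-- would give p ≡ 0 (mod q).
embedding⇒≤ : ∀ {p q} → FieldEmbedding p q → p ≤ q
embedding⇒≤ {p} {q} E = injection⇒≤ p q emb (λ _ → emb<q) (λ _ _ → injective)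
  where open FieldEmbedding E

embedding⇒≮ : ∀ {p q} → 2 ≤ p → FieldEmbedding p q → ¬ p < q
embedding⇒≮ {suc (suc m)} {q} 2≤p@(s≤s (s≤s _)) E p<q = wrap-around (suc m) ≤-refl refl
  where
    open FieldEmbedding E
    p = suc (suc m)
    0<p : 0 < p
    0<p = z<s
    emb-0 : emb 0 ≡ 0
    emb-0 = proj₂ (preserves (fs (fs fz)) (0 ∷ []) (0<p ∷ []) (0<p , refl))
    emb-1 : emb 1 ≡ 1
    emb-1 = proj₂ (preserves (fs (fs (fs fz))) (1 ∷ []) (2≤p ∷ []) (2≤p , refl))
    emb-+ : ∀ {a b c} → a < p → b < p → c < p → a + b ≡ c ⊎ a + b ≡ c + p →
            emb a + emb b ≡ emb c ⊎ emb a + emb b ≡ emb c + q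
    emb-+ a<p b<p c<p sum = proj₂ (proj₂ (proj₂ (preserves fz (_ ∷ _ ∷ _ ∷ []) (a<p ∷ b<p ∷ c<p ∷ [])
                                                        (a<p , b<p , c<p , sum))))
    -- below p no addition wraps around modulo q, so emb is the identity
    emb-id  : ∀ k → k < p → emb k ≡ k
    emb-suc : ∀ k → k < p → suc k < p → emb (suc k) ≡ suc k
    emb-id zero    _     = emb-0
    emb-id (suc k) 1+k<p = emb-suc k (<-trans (n<1+n k) 1+k<p) 1+k<p
    emb-suc k k<p 1+k<p with emb-+ 2≤p k<p 1+k<p (inj₁ refl)
    ... | inj₁ sum = begin
      emb (suc k)            ≡⟨ sum ⟨
      emb 1 + emb k          ≡⟨ cong₂ _+_ emb-1 (emb-id k k<p) ⟩
      suc k                  ∎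
      where open ≡-Reasoning
    ... | inj₂ sum = ⊥-elim (<-irrefl refl (begin-strict
      q                      ≤⟨ m≤n+m q (emb (suc k)) ⟩
      emb (suc k) + q        ≡⟨ sum ⟨
      emb 1 + emb k          ≡⟨ cong₂ _+_ emb-1 (emb-id k k<p) ⟩
      suc k                  <⟨ <-trans 1+k<p p<q ⟩
      q                      ∎))
      where open ≤-Reasoning
    -- 1 + (p - 1) = 0 + p in 𝔽_p, but 1 + (p - 1) is neither 0 nor q
    wrap-around : ∀ k → k < p → suc k ≡ p → ⊥
    wrap-around k k<p 1+k≡p with emb-+ 2≤p k<p 0<p (inj₂ 1+k≡p)
    ... | inj₁ sum = 0≢1+n (begin
      0                      ≡⟨ emb-0 ⟨
      emb 0                  ≡⟨ sum ⟨
      emb 1 + emb k          ≡⟨ cong₂ _+_ emb-1 (emb-id k k<p) ⟩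
      suc k                  ∎)
      where open ≡-Reasoning
    ... | inj₂ sum = <-irrefl (begin
      p                      ≡⟨ 1+k≡p ⟨
      suc k                  ≡⟨ cong₂ _+_ emb-1 (emb-id k k<p) ⟨
      emb 1 + emb k          ≡⟨ sum ⟩
      emb 0 + q              ≡⟨ cong (_+ q) emb-0 ⟩
      q                      ∎) p<q
      where open ≡-Reasoning

embedding⇒≡ : ∀ {p q} → 2 ≤ p → FieldEmbedding p q → p ≡ q
embedding⇒≡ 2≤p E = ≤-antisym (embedding⇒≤ E) (≮⇒≥ (embedding⇒≮ 2≤p E))

prime⇒2≤ : ∀ {p} → Prime p → 2 ≤ p
prime⇒2≤ {p} p-prime = nonTrivial⇒n>1 p {{prime⇒nonTrivial p-prime}}

natOrder-mono : ∀ {S T : ℕ → Set} → (∀ {x} → S x → T x) → ∀ φ → D (natOrder S) φ → D (natOrder T) φ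
natOrder-mono S⊆T (pos (eq a b)) ((Sa , Sb) , a≡b) = (S⊆T Sa , S⊆T Sb) , a≡b
natOrder-mono S⊆T (neg (eq a b)) ((Sa , Sb) , a≢b) = (S⊆T Sa , S⊆T Sb) , a≢b
natOrder-mono S⊆T (pos (rel fz (a ∷ b ∷ []))) ((Sa ∷ Sb ∷ []) , a≤b) = (S⊆T Sa ∷ S⊆T Sb ∷ []) , a≤b
natOrder-mono S⊆T (neg (rel fz (a ∷ b ∷ []))) ((Sa ∷ Sb ∷ []) , a≰b) = (S⊆T Sa ∷ S⊆T Sb ∷ []) , a≰b

Ord-FLO : ∀ p → FLO (Ord p)
Ord-FLO p = (upTo p , λ _ → ∈-upTo⁺ , ∈-upTo⁻) , natOrder-linear (_< p)

FLO≰cPF : ¬ (FLO ≤c PF)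
FLO≰cPF (e , Φ-emb) with total (Ord 1) (Ord-FLO 1) | total (Ord 2) (Ord-FLO 2)
  where open IsCompTransf (IsCompEmb.transf Φ-emb)
... | B₁ , (p , p-prime , Fp≅B₁) , out₁ | B₂ , (q , _ , Fq≅B₂) , out₂ =
  Ord1≇Ord2 (proj₂ (IsCompEmb.embed Φ-emb _ _ B₁ B₂ (Ord-FLO 1) (Ord-FLO 2) out₁ out₂) B₁≅B₂)
  where
    p≡q : p ≡ q
    p≡q = embedding⇒≡ (prime⇒2≤ p-prime) (diagramInclusion⇒embedding Fp≅B₁ Fq≅B₂
            (Out-mono (natOrder-mono (λ x<1 → m<n⇒m<1+n x<1)) out₁ out₂))
    B₁≅B₂ : Iso B₁ B₂
    B₁≅B₂ = Iso-via Fp (Iso-sym Fp≅B₁) p≡q Fq≅B₂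
    Ord1≇Ord2 : ¬ Iso (Ord 1) (Ord 2)
    Ord1≇Ord2 i with Iso⇒≡ i (λ _ → ⟺-refl) (λ _ → ⟺-refl)
    ... | ()

proposition2p1 : (PF ≤c FLO) × ¬ (FLO ≤c PF)
proposition2p1 = PF≤cFLO , FLO≰cPF
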